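{- For all $(n,p)\in\mathbb{N}^2$ with $n\ge p$, we have $Sr(n,p)=T(n+1,p+1)$.
   Context: $\mathbb{N}=\{1,2,3,\dots\}$ and $[n]=\{1,2,\dots,n\}$. For $(n,p)\in\mathbb{N}^2$, define $$Sr(n,p)=\left|\{F\subset[n] : F\neq\emptyset,\ p\min F\ge |F| \text{ and } F \text{ is an interval (a set of consecutive integers)}\}\right|.$$ For integers $N\ge 1$ and $r\ge 1$, the Turán graph on $N$ vertices with $r$ parts is the complete $r$-partite graph on $N$ vertices whose parts differ in size by at most $1$ (two vertices are adjacent if and only if they lie in different parts); $T(N,r)$ denotes the number of edges of this graph. -}

module Defs where

open import Data.Bool using (Bool; true; false; _∧_; _∨_; not; if_then_else_)
open import Data.Nat using (ℕ; zero; suc; _+_; _*_; _≤ᵇ_; _≡ᵇ_; NonZero)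
open import Data.Nat.DivMod using (_%_)
open import Data.Fin using (Fin; toℕ)
open import Data.Fin.Subset using (Subset; ∣_∣)
open import Data.List using (List; []; _∷_; map; _++_; filter; length; allFin; upTo; concatMap)
open import Data.Bool.ListAction using (all; any)
open import Data.Vec using (Vec; []; _∷_; lookup)
open import Function using (_∘_)
open import Data.Product using (_×_; _,_)
open import Relation.Nullary.Decidable using (does)
open import Relation.Binary.PropositionalEquality using (_≡_)
open import Data.Bool.Properties using () renaming (_≟_ to _≟ᵇ_)

-- A subset F ⊆ [n] is represented by F : Subset n = Vec Bool n,
-- where index i : Fin n stands for the integer (toℕ i + 1) ∈ [n].

allSubsets : (n : ℕ) → List (Subset n)
allSubsets zero = [] ∷ []
allSubsets (suc n) = map (true ∷_) (allSubsets n) ++ map (false ∷_) (allSubsets n)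

mem : ∀ {n} → Subset n → Fin n → Bool
mem F i = lookup F i

nonemptyᵇ : ∀ {n} → Subset n → Bool
nonemptyᵇ {n} F = any (mem F) (allFin n)

intervalᵇ : ∀ {n} → Subset n → Bool
intervalᵇ {n} F =
  all (λ a → all (λ b → all (λ c →
    not ((toℕ a ≤ᵇ toℕ b) ∧ (toℕ b ≤ᵇ toℕ c) ∧ mem F a ∧ mem F c) ∨ mem F b)
    (allFin n)) (allFin n)) (allFin n)

-- min F as an integer in [n] (the least member); returns 0 for F = ∅
minSet : ∀ {n} → Subset n → ℕ
minSet [] = 0
minSet (true ∷ F) = 1
minSet (false ∷ F) with minSet F
... | zero = 0
... | suc m = suc (suc m)

goodᵇ : ∀ {n} → ℕ → Subset n → Bool
goodᵇ p F = nonemptyᵇ F ∧ (∣ F ∣ ≤ᵇ p * minSet F) ∧ intervalᵇ F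

Sr : ℕ → ℕ → ℕ
Sr n p = length (filter (λ F → goodᵇ p F ≟ᵇ true) (allSubsets n))

-- Turán graph T(N,r): vertices 0,…,N-1, vertex v lies in part (v mod r);
-- the r parts then have sizes ⌊N/r⌋ or ⌈N/r⌉ (differ by at most 1).
T : (N r : ℕ) → .{{NonZero r}} → ℕ
T N r = length (filter (λ uv → adj uv ≟ᵇ true) pairs)
  where
  pairs : List (ℕ × ℕ)
  pairs = concatMap (λ v → map (λ u → (u , v)) (upTo v)) (upTo N)
  adj : ℕ × ℕ → Bool
  adj (u , v) = not ((u % r) ≡ᵇ (v % r))

{-# OPTIONS --safe #-}
-- An interval [a, b] ⊆ [n] satisfies p·a ≥ b − a + 1 iff (p + 1)·a > b, so for each right end b
-- exactly b − ⌊b/(p+1)⌋ left ends are admissible.  In T(n+1, p+1), where vertex v lies in part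
-- v mod (p+1), vertex b has exactly ⌊b/(p+1)⌋ smaller vertices in its own part, hence
-- b − ⌊b/(p+1)⌋ smaller neighbours.  Summing over b = 1, …, n gives both sides.
-- Subsets, being bit vectors headed by the element 1, are naturally counted by their left end;
-- regrouping that count by right end is a purely arithmetic step.
module Submission where

open import Defs
open import Data.Bool using (Bool; true; false; _∧_; _∨_; not; if_then_else_)
open import Data.Bool.Properties using (∧-comm; ∧-zeroʳ; ∨-zeroʳ; ∨-identityʳ) renaming (_≟_ to _≟ᵇ_)
open import Data.Bool.ListAction using (all; any; and; or)
open import Data.Fin using (Fin; toℕ) renaming (zero to fzero; suc to fsuc)
open import Data.Fin.Subset using (Subset; ∣_∣)
open import Data.List using (List; []; _∷_; map; _++_; [_]; concatMap; filter; length; allFin; upTo)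
open import Data.List.Properties using (map-tabulate; map-upTo; upTo-∷ʳ; concatMap-++; ++-identityʳ; length-upTo)
open import Data.Nat using (ℕ; zero; suc; _+_; _*_; _∸_; _≤ᵇ_; _≡ᵇ_; _≤_; _<_; _≥_; s≤s; s≤s⁻¹; NonZero)
open import Data.Nat.Properties
open import Algebra.Properties.CommutativeSemigroup +-commutativeSemigroup using (interchange)
open import Data.Nat.DivMod using (_/_; _%_; m≡m%n+[m/n]*n; [m+kn]%n≡m%n; m%n<n; m<n⇒m%n≡m; n%n≡0; %-pred-≡0; m/n*n≤m; m*n/n≡m; /-monoˡ-≤; m<n*o⇒m/o<n)
open import Data.Product using (_×_; _,_)
open import Data.Sum using (_⊎_; inj₁; inj₂)
open import Data.Vec using ([]; _∷_)
open import Function using (_∘_)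
open import Function.Bundles using (_⇔_; mk⇔; module Equivalence)
open import Relation.Nullary using (yes; no)
open import Relation.Nullary.Decidable using (dec-true; dec-false; does-⇔)
open import Relation.Binary.PropositionalEquality using (_≡_; refl; sym; trans; cong; cong₂; subst; module ≡-Reasoning)

𝟙 : Bool → ℕ
𝟙 b = if b then 1 else 0

count : {A : Set} → (A → Bool) → List A → ℕ
count P [] = 0
count P (x ∷ xs) = 𝟙 (P x) + count P xs

length-filter≡count : {A : Set} (P : A → Bool) (xs : List A) →
                      length (filter (λ x → P x ≟ᵇ true) xs) ≡ count P xs
length-filter≡count P [] = refl
length-filter≡count P (x ∷ xs) with P x
... | true  = cong suc (length-filter≡count P xs)
... | false = length-filter≡count P xs

count-++ : {A : Set} (P : A → Bool) (xs ys : List A) → count P (xs ++ ys) ≡ count P xs + count P ys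
count-++ P [] ys = refl
count-++ P (x ∷ xs) ys = trans (cong (𝟙 (P x) +_) (count-++ P xs ys)) (sym (+-assoc (𝟙 (P x)) _ _))

count-map : {A B : Set} (P : B → Bool) (f : A → B) (xs : List A) → count P (map f xs) ≡ count (P ∘ f) xs
count-map P f [] = refl
count-map P f (x ∷ xs) = cong (𝟙 (P (f x)) +_) (count-map P f xs)

count-cong : {A : Set} {P Q : A → Bool} → (∀ x → P x ≡ Q x) → (xs : List A) → count P xs ≡ count Q xs
count-cong P≗Q [] = refl
count-cong P≗Q (x ∷ xs) = cong₂ _+_ (cong 𝟙 (P≗Q x)) (count-cong P≗Q xs)

count-not+count≡length : {A : Set} (P : A → Bool) (xs : List A) → count (not ∘ P) xs + count P xs ≡ length xs
count-not+count≡length P [] = refl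
count-not+count≡length P (x ∷ xs) with P x
... | true  = trans (+-suc _ _) (cong suc (count-not+count≡length P xs))
... | false = cong suc (count-not+count≡length P xs)

count-not : {A : Set} (P : A → Bool) (xs : List A) → count (not ∘ P) xs ≡ length xs ∸ count P xs
count-not P xs = trans (sym (m+n∸n≡m _ (count P xs))) (cong (_∸ count P xs) (count-not+count≡length P xs))

count-upTo-sucˡ : (P : ℕ → Bool) (n : ℕ) → count P (upTo (suc n)) ≡ 𝟙 (P 0) + count (P ∘ suc) (upTo n)
count-upTo-sucˡ P n = cong (𝟙 (P 0) +_) (trans (cong (count P) (sym (map-upTo suc n))) (count-map P suc (upTo n)))

count-upTo-sucʳ : (P : ℕ → Bool) (n : ℕ) → count P (upTo (suc n)) ≡ count P (upTo n) + 𝟙 (P n)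
count-upTo-sucʳ P n = begin
  count P (upTo (suc n))          ≡⟨ cong (count P) (sym (upTo-∷ʳ n)) ⟩
  count P (upTo n ++ [ n ])       ≡⟨ count-++ P (upTo n) [ n ] ⟩
  count P (upTo n) + (𝟙 (P n) + 0) ≡⟨ cong (count P (upTo n) +_) (+-identityʳ _) ⟩
  count P (upTo n) + 𝟙 (P n)      ∎
  where open ≡-Reasoning

count-≤ᵇ-upTo : (k n : ℕ) → count (k ≤ᵇ_) (upTo n) ≡ n ∸ k
count-≤ᵇ-upTo k zero = sym (0∸n≡0 k)
count-≤ᵇ-upTo k (suc n) with k ≤? n
... | yes k≤n = begin
  count (k ≤ᵇ_) (upTo (suc n))          ≡⟨ count-upTo-sucʳ (k ≤ᵇ_) n ⟩
  count (k ≤ᵇ_) (upTo n) + 𝟙 (k ≤ᵇ n) ≡⟨ cong₂ _+_ (count-≤ᵇ-upTo k n) (cong 𝟙 (dec-true (k ≤? n) k≤n)) ⟩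
  n ∸ k + 1                             ≡⟨ +-comm (n ∸ k) 1 ⟩
  1 + (n ∸ k)                           ≡⟨ sym (+-∸-assoc 1 k≤n) ⟩
  suc n ∸ k                             ∎
  where open ≡-Reasoning
... | no k≰n = begin
  count (k ≤ᵇ_) (upTo (suc n))          ≡⟨ count-upTo-sucʳ (k ≤ᵇ_) n ⟩
  count (k ≤ᵇ_) (upTo n) + 𝟙 (k ≤ᵇ n) ≡⟨ cong₂ _+_ (count-≤ᵇ-upTo k n) (cong 𝟙 (dec-false (k ≤? n) k≰n)) ⟩
  n ∸ k + 0                             ≡⟨ cong (_+ 0) (m≤n⇒m∸n≡0 (≤-trans (n≤1+n n) n<k)) ⟩
  0                                     ≡⟨ sym (m≤n⇒m∸n≡0 n<k) ⟩
  suc n ∸ k                             ∎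
  where
  open ≡-Reasoning
  n<k : n < k
  n<k = ≰⇒> k≰n

-- Intervals as bit vectors

all-allFin-suc : ∀ {n} (q : Fin (suc n) → Bool) → all q (allFin (suc n)) ≡ q fzero ∧ all (q ∘ fsuc) (allFin n)
all-allFin-suc {n} q = cong (q fzero ∧_) (cong and (trans (map-tabulate fsuc q) (sym (map-tabulate (λ i → i) (q ∘ fsuc)))))

any-allFin-suc : ∀ {n} (q : Fin (suc n) → Bool) → any q (allFin (suc n)) ≡ q fzero ∨ any (q ∘ fsuc) (allFin n)
any-allFin-suc {n} q = cong (q fzero ∨_) (cong or (trans (map-tabulate fsuc q) (sym (map-tabulate (λ i → i) (q ∘ fsuc)))))

all-cong : ∀ {A : Set} {q r : A → Bool} → (∀ x → q x ≡ r x) → (xs : List A) → all q xs ≡ all r xs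
all-cong q≗r [] = refl
all-cong q≗r (x ∷ xs) = cong₂ _∧_ (q≗r x) (all-cong q≗r xs)

all-true : ∀ {A : Set} {q : A → Bool} → (∀ x → q x ≡ true) → (xs : List A) → all q xs ≡ true
all-true q≗true [] = refl
all-true q≗true (x ∷ xs) rewrite q≗true x = all-true q≗true xs

all² : ∀ {n} → (Fin n → Fin n → Bool) → Bool
all² {n} χ = all (λ b → all (χ b) (allFin n)) (allFin n)

all³ : ∀ {n} → (Fin n → Fin n → Fin n → Bool) → Bool
all³ {n} ψ = all (λ a → all² (ψ a)) (allFin n)

all²-cong : ∀ {n} {χ χ′ : Fin n → Fin n → Bool} → (∀ b c → χ b c ≡ χ′ b c) → all² χ ≡ all² χ′
all²-cong {n} χ≗χ′ = all-cong (λ b → all-cong (χ≗χ′ b) (allFin n)) (allFin n)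

all²-suc : ∀ {n} (χ : Fin (suc n) → Fin (suc n) → Bool) → (∀ b → χ (fsuc b) fzero ≡ true) →
           all² χ ≡ all (χ fzero) (allFin (suc n)) ∧ all² (λ b c → χ (fsuc b) (fsuc c))
all²-suc {n} χ below≡true =
  trans (all-allFin-suc row) (cong (row fzero ∧_) (all-cong row-suc (allFin n)))
  where
  row : Fin (suc n) → Bool
  row b = all (χ b) (allFin (suc n))
  row-suc : ∀ b → row (fsuc b) ≡ all (λ c → χ (fsuc b) (fsuc c)) (allFin n)
  row-suc b = trans (all-allFin-suc (χ (fsuc b))) (cong (_∧ all (λ c → χ (fsuc b) (fsuc c)) (allFin n)) (below≡true b))

all³-suc : ∀ {n} (ψ : Fin (suc n) → Fin (suc n) → Fin (suc n) → Bool) →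
           (∀ a c → ψ (fsuc a) fzero c ≡ true) → (∀ a b → ψ (fsuc a) (fsuc b) fzero ≡ true) →
           all³ ψ ≡ all² (ψ fzero) ∧ all³ (λ a b c → ψ (fsuc a) (fsuc b) (fsuc c))
all³-suc {n} ψ below₁≡true below₂≡true =
  trans (all-allFin-suc (all² ∘ ψ)) (cong (all² (ψ fzero) ∧_) (all-cong slice-suc (allFin n)))
  where
  slice-suc : ∀ a → all² (ψ (fsuc a)) ≡ all² (λ b c → ψ (fsuc a) (fsuc b) (fsuc c))
  slice-suc a = trans (all²-suc (ψ (fsuc a)) (below₂≡true a))
    (cong (_∧ all² (λ b c → ψ (fsuc a) (fsuc b) (fsuc c))) (all-true (below₁≡true a) (allFin (suc n))))

∧-absorbs-implied : ∀ x {y} → (x ≡ true → y ≡ true) → x ∧ y ≡ x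
∧-absorbs-implied false _ = refl
∧-absorbs-implied true {true} _ = refl
∧-absorbs-implied true {false} x⇒y with x⇒y refl
... | ()

suc≤ᵇsuc : ∀ m n → (suc m ≤ᵇ suc n) ≡ (m ≤ᵇ n)
suc≤ᵇsuc zero n = refl
suc≤ᵇsuc (suc m) n = refl

isEmpty : ∀ {n} → Subset n → Bool
isEmpty [] = true
isEmpty (x ∷ F) = not x ∧ isEmpty F

isInitial : ∀ {n} → Subset n → Bool
isInitial [] = true
isInitial (true ∷ F) = isInitial F
isInitial (false ∷ F) = isEmpty F

isInterval : ∀ {n} → Subset n → Bool
isInterval [] = true
isInterval (true ∷ F) = isInitial F
isInterval (false ∷ F) = isInterval F

isEmpty⇒isInitial : ∀ {n} (F : Subset n) → isEmpty F ≡ true → isInitial F ≡ true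
isEmpty⇒isInitial [] _ = refl
isEmpty⇒isInitial (false ∷ F) empty = empty

isInitial⇒isInterval : ∀ {n} (F : Subset n) → isInitial F ≡ true → isInterval F ≡ true
isInitial⇒isInterval [] _ = refl
isInitial⇒isInterval (true ∷ F) initial = initial
isInitial⇒isInterval (false ∷ F) empty = isInitial⇒isInterval F (isEmpty⇒isInitial F empty)

all-not-mem≡isEmpty : ∀ {n} (F : Subset n) → all (not ∘ mem F) (allFin n) ≡ isEmpty F
all-not-mem≡isEmpty [] = refl
all-not-mem≡isEmpty (x ∷ F) = trans (all-allFin-suc (not ∘ mem (x ∷ F))) (cong (not x ∧_) (all-not-mem≡isEmpty F))

nonemptyᵇ-∷ : ∀ {n} (x : Bool) (F : Subset n) → nonemptyᵇ (x ∷ F) ≡ x ∨ nonemptyᵇ F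
nonemptyᵇ-∷ x F = any-allFin-suc (mem (x ∷ F))

downwardᵇ : ∀ {n} → Subset n → Fin n → Fin n → Bool
downwardᵇ F b c = not ((toℕ b ≤ᵇ toℕ c) ∧ mem F c) ∨ mem F b

downClosedᵇ : ∀ {n} → Subset n → Bool
downClosedᵇ F = all² (downwardᵇ F)

downClosedᵇ-∷ : ∀ {n} (x : Bool) (F : Subset n) →
                downClosedᵇ (x ∷ F) ≡ all (λ c → not (mem (x ∷ F) c) ∨ x) (allFin (suc n)) ∧ downClosedᵇ F
downClosedᵇ-∷ {n} x F = trans (all²-suc (downwardᵇ (x ∷ F)) (λ _ → refl))
  (cong (all (downwardᵇ (x ∷ F) fzero) (allFin (suc n)) ∧_) (all²-cong shift))
  where
  shift : ∀ b c → downwardᵇ (x ∷ F) (fsuc b) (fsuc c) ≡ downwardᵇ F b c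
  shift b c rewrite suc≤ᵇsuc (toℕ b) (toℕ c) = refl

downClosedᵇ≡isInitial : ∀ {n} (F : Subset n) → downClosedᵇ F ≡ isInitial F
downClosedᵇ≡isInitial [] = refl
downClosedᵇ≡isInitial {suc n} (true ∷ F) = trans (downClosedᵇ-∷ true F)
  (cong₂ _∧_ (all-true (λ c → ∨-zeroʳ (not (mem (true ∷ F) c))) (allFin (suc n))) (downClosedᵇ≡isInitial F))
downClosedᵇ≡isInitial {suc n} (false ∷ F) = begin
  downClosedᵇ (false ∷ F)
    ≡⟨ downClosedᵇ-∷ false F ⟩
  all (λ c → not (mem (false ∷ F) c) ∨ false) (allFin (suc n)) ∧ downClosedᵇ F
    ≡⟨ cong (_∧ downClosedᵇ F) (all-allFin-suc (λ c → not (mem (false ∷ F) c) ∨ false)) ⟩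
  all (λ c → not (mem F c) ∨ false) (allFin n) ∧ downClosedᵇ F
    ≡⟨ cong₂ _∧_ (trans (all-cong (λ c → ∨-identityʳ _) (allFin n)) (all-not-mem≡isEmpty F)) (downClosedᵇ≡isInitial F) ⟩
  isEmpty F ∧ isInitial F
    ≡⟨ ∧-absorbs-implied (isEmpty F) (isEmpty⇒isInitial F) ⟩
  isEmpty F ∎
  where open ≡-Reasoning

convexᵇ : ∀ {n} → Subset n → Fin n → Fin n → Fin n → Bool
convexᵇ F a b c = not ((toℕ a ≤ᵇ toℕ b) ∧ (toℕ b ≤ᵇ toℕ c) ∧ mem F a ∧ mem F c) ∨ mem F b

intervalᵇ-∷ : ∀ {n} (x : Bool) (F : Subset n) → intervalᵇ (x ∷ F) ≡ all² (convexᵇ (x ∷ F) fzero) ∧ intervalᵇ F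
intervalᵇ-∷ x F = trans (all³-suc (convexᵇ (x ∷ F)) (λ _ _ → refl) last-below)
  (cong (all² (convexᵇ (x ∷ F) fzero) ∧_) (all-cong (λ a → all²-cong (shift a)) (allFin _)))
  where
  last-below : ∀ a b → convexᵇ (x ∷ F) (fsuc a) (fsuc b) fzero ≡ true
  last-below a b with suc (toℕ a) ≤ᵇ suc (toℕ b)
  ... | true = refl
  ... | false = refl
  shift : ∀ a b c → convexᵇ (x ∷ F) (fsuc a) (fsuc b) (fsuc c) ≡ convexᵇ F a b c
  shift a b c rewrite suc≤ᵇsuc (toℕ a) (toℕ b) | suc≤ᵇsuc (toℕ b) (toℕ c) = refl

intervalᵇ≡isInterval : ∀ {n} (F : Subset n) → intervalᵇ F ≡ isInterval F
intervalᵇ≡isInterval [] = refl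
intervalᵇ≡isInterval (true ∷ F) = begin
  intervalᵇ (true ∷ F)                  ≡⟨ intervalᵇ-∷ true F ⟩
  downClosedᵇ (true ∷ F) ∧ intervalᵇ F ≡⟨ cong₂ _∧_ (downClosedᵇ≡isInitial (true ∷ F)) (intervalᵇ≡isInterval F) ⟩
  isInitial F ∧ isInterval F            ≡⟨ ∧-absorbs-implied (isInitial F) (isInitial⇒isInterval F) ⟩
  isInitial F                           ∎
  where open ≡-Reasoning
intervalᵇ≡isInterval {suc n} (false ∷ F) = trans (intervalᵇ-∷ false F)
  (cong₂ _∧_ (all-true (λ b → all-true (first-absent b) (allFin (suc n))) (allFin (suc n))) (intervalᵇ≡isInterval F))
  where
  first-absent : ∀ b c → convexᵇ (false ∷ F) fzero b c ≡ true
  first-absent b c rewrite ∧-zeroʳ (toℕ b ≤ᵇ toℕ c) = refl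

-- Counting intervals

count-allSubsets-suc : ∀ n (P : Subset (suc n) → Bool) →
  count P (allSubsets (suc n)) ≡ count (P ∘ (true ∷_)) (allSubsets n) + count (P ∘ (false ∷_)) (allSubsets n)
count-allSubsets-suc n P = trans (count-++ P (map (true ∷_) (allSubsets n)) _)
  (cong₂ _+_ (count-map P (true ∷_) (allSubsets n)) (count-map P (false ∷_) (allSubsets n)))

count-false : ∀ {A : Set} (xs : List A) → count (λ _ → false) xs ≡ 0
count-false [] = refl
count-false (_ ∷ xs) = count-false xs

count-isEmpty : ∀ n (P : ℕ → Bool) → count (λ F → isEmpty F ∧ P ∣ F ∣) (allSubsets n) ≡ 𝟙 (P 0)
count-isEmpty zero P = +-identityʳ (𝟙 (P 0))
count-isEmpty (suc n) P = trans (count-allSubsets-suc n (λ F → isEmpty F ∧ P ∣ F ∣))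
  (cong₂ _+_ (count-false (allSubsets n)) (count-isEmpty n P))

count-isInitial : ∀ n (P : ℕ → Bool) → count (λ F → isInitial F ∧ P ∣ F ∣) (allSubsets n) ≡ count P (upTo (suc n))
count-isInitial zero P = refl
count-isInitial (suc n) P = begin
  count (λ F → isInitial F ∧ P ∣ F ∣) (allSubsets (suc n))
    ≡⟨ count-allSubsets-suc n (λ F → isInitial F ∧ P ∣ F ∣) ⟩
  count (λ F → isInitial F ∧ P (suc ∣ F ∣)) (allSubsets n) + count (λ F → isEmpty F ∧ P ∣ F ∣) (allSubsets n)
    ≡⟨ cong₂ _+_ (count-isInitial n (P ∘ suc)) (count-isEmpty n P) ⟩
  count (P ∘ suc) (upTo (suc n)) + 𝟙 (P 0)
    ≡⟨ +-comm _ (𝟙 (P 0)) ⟩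
  𝟙 (P 0) + count (P ∘ suc) (upTo (suc n))
    ≡⟨ sym (count-upTo-sucˡ P (suc n)) ⟩
  count P (upTo (suc (suc n))) ∎
  where open ≡-Reasoning

minSet-false : ∀ {n} (F : Subset n) → nonemptyᵇ F ≡ true → minSet (false ∷ F) ≡ suc (minSet F)
minSet-false (true ∷ F) _ = refl
minSet-false (false ∷ F) nonempty rewrite minSet-false F (trans (sym (nonemptyᵇ-∷ false F)) nonempty) = refl

intervalWithᵇ : ∀ {n} → (ℕ → ℕ → Bool) → Subset n → Bool
intervalWithᵇ R F = nonemptyᵇ F ∧ (isInterval F ∧ R (minSet F) ∣ F ∣)

intervalWithᵇ-false : ∀ {n} (R : ℕ → ℕ → Bool) (F : Subset n) →
                      intervalWithᵇ R (false ∷ F) ≡ intervalWithᵇ (R ∘ suc) F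
intervalWithᵇ-false R F rewrite nonemptyᵇ-∷ false F with nonemptyᵇ F in nonempty
... | true  rewrite minSet-false F nonempty = refl
... | false = refl

-- The number of pairs (a , ℓ) with a, ℓ ≥ 1, a + ℓ ≤ n + 1 and R a ℓ: intervals of [n] by minimum and size.
countIntervals : (ℕ → ℕ → Bool) → ℕ → ℕ
countIntervals R zero = 0
countIntervals R (suc n) = count (R 1 ∘ suc) (upTo (suc n)) + countIntervals (R ∘ suc) n

count-intervalWithᵇ : ∀ n (R : ℕ → ℕ → Bool) → count (intervalWithᵇ R) (allSubsets n) ≡ countIntervals R n
count-intervalWithᵇ zero R = refl
count-intervalWithᵇ (suc n) R = trans (count-allSubsets-suc n (intervalWithᵇ R))
  (cong₂ _+_ (count-isInitial n (R 1 ∘ suc))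
             (trans (count-cong (intervalWithᵇ-false R) (allSubsets n)) (count-intervalWithᵇ n (R ∘ suc))))

-- The intervals ending at n + 1 are those with minimum i + 1 and size n + 1 − i, for i ≤ n.
countIntervals-suc : ∀ n (R : ℕ → ℕ → Bool) →
  countIntervals R (suc n) ≡ countIntervals R n + count (λ i → R (suc i) (suc n ∸ i)) (upTo (suc n))
countIntervals-suc zero R = +-identityʳ _
countIntervals-suc (suc n) R = begin
  count (R 1 ∘ suc) (upTo (suc (suc n))) + countIntervals (R ∘ suc) (suc n)
    ≡⟨ cong₂ _+_ (count-upTo-sucʳ (R 1 ∘ suc) (suc n)) (countIntervals-suc n (R ∘ suc)) ⟩
  (count (R 1 ∘ suc) (upTo (suc n)) + 𝟙 (R 1 (suc (suc n))))
    + (countIntervals (R ∘ suc) n + count (λ i → R (suc (suc i)) (suc n ∸ i)) (upTo (suc n)))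
    ≡⟨ interchange (count (R 1 ∘ suc) (upTo (suc n))) (𝟙 (R 1 (suc (suc n)))) (countIntervals (R ∘ suc) n) _ ⟩
  countIntervals R (suc n) + (𝟙 (R 1 (suc (suc n))) + count (λ i → R (suc (suc i)) (suc n ∸ i)) (upTo (suc n)))
    ≡⟨ cong (countIntervals R (suc n) +_) (sym (count-upTo-sucˡ (λ i → R (suc i) (suc (suc n) ∸ i)) (suc n))) ⟩
  countIntervals R (suc n) + count (λ i → R (suc i) (suc (suc n) ∸ i)) (upTo (suc (suc n))) ∎
  where open ≡-Reasoning

-- Division and residues

m/o<n⇒m<n*o : ∀ {m n o} .{{_ : NonZero o}} → m / o < n → m < n * o
m/o<n⇒m<n*o {m} {n} {o} m/o<n = ≰⇒> λ n*o≤m →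
  <⇒≱ m/o<n (subst (_≤ m / o) (m*n/n≡m n o) (/-monoˡ-≤ o n*o≤m))

m∸n≤o*[1+n]⇔m<[1+o]*[1+n] : ∀ m n o → m ∸ n ≤ o * suc n ⇔ m < suc o * suc n
m∸n≤o*[1+n]⇔m<[1+o]*[1+n] m n o = mk⇔
  (λ m∸n≤o*[1+n] → s≤s (≤-trans (m≤n+m∸n m n) (+-monoʳ-≤ n m∸n≤o*[1+n])))
  (λ m<[1+o]*[1+n] → m≤n+o⇒m∸n≤o m n (s≤s⁻¹ m<[1+o]*[1+n]))

m∸n≤o*[1+n]⇔m/[1+o]≤n : ∀ m n o → m ∸ n ≤ o * suc n ⇔ m / suc o ≤ n
m∸n≤o*[1+n]⇔m/[1+o]≤n m n o = mk⇔
  (λ m∸n≤o*[1+n] → s≤s⁻¹ (m<n*o⇒m/o<n (subst (m <_) (*-comm (suc o) (suc n)) (to m∸n≤o*[1+n]))))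
  (λ m/[1+o]≤n → from (subst (m <_) (*-comm (suc n) (suc o)) (m/o<n⇒m<n*o (s≤s m/[1+o]≤n))))
  where open Equivalence (m∸n≤o*[1+n]⇔m<[1+o]*[1+n] m n o)

count-∸≤ᵇ*suc-upTo : ∀ m p → count (λ i → m ∸ i ≤ᵇ p * suc i) (upTo m) ≡ m ∸ m / suc p
count-∸≤ᵇ*suc-upTo m p = trans
  (count-cong (λ i → does-⇔ (m∸n≤o*[1+n]⇔m/[1+o]≤n m i p) (m ∸ i ≤? p * suc i) (m / suc p ≤? i)) (upTo m))
  (count-≤ᵇ-upTo (m / suc p) m)

[1+m]%n≡[1+m%n]%n : ∀ m n .{{_ : NonZero n}} → suc m % n ≡ suc (m % n) % n
[1+m]%n≡[1+m%n]%n m n = trans (cong (λ m′ → suc m′ % n) (m≡m%n+[m/n]*n m n)) ([m+kn]%n≡m%n (suc (m % n)) (m / n) n)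

[1+m]%n≡0⊎[1+m]%n≡1+m%n : ∀ m n .{{_ : NonZero n}} → suc m % n ≡ 0 ⊎ suc m % n ≡ suc (m % n)
[1+m]%n≡0⊎[1+m]%n≡1+m%n m n with m≤n⇒m<n∨m≡n (m%n<n m n)
... | inj₁ [1+m%n]<n = inj₂ (trans ([1+m]%n≡[1+m%n]%n m n) (m<n⇒m%n≡m [1+m%n]<n))
... | inj₂ [1+m%n]≡n = inj₁ (trans ([1+m]%n≡[1+m%n]%n m n) (trans (cong (_% n) [1+m%n]≡n) (n%n≡0 n)))

[1+m]%o≡[1+n]%o⇔m%o≡n%o : ∀ m n o .{{_ : NonZero o}} → suc m % o ≡ suc n % o ⇔ m % o ≡ n % o
[1+m]%o≡[1+n]%o⇔m%o≡n%o m n o = mk⇔ to from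
  where
  to : suc m % o ≡ suc n % o → m % o ≡ n % o
  to eq with [1+m]%n≡0⊎[1+m]%n≡1+m%n m o | [1+m]%n≡0⊎[1+m]%n≡1+m%n n o
  ... | inj₁ m₀ | inj₁ n₀ = trans (%-pred-≡0 m₀) (sym (%-pred-≡0 n₀))
  ... | inj₁ m₀ | inj₂ n₊ with trans (sym m₀) (trans eq n₊)
  ... | ()
  to eq | inj₂ m₊ | inj₁ n₀ with trans (sym m₊) (trans eq n₀)
  ... | ()
  to eq | inj₂ m₊ | inj₂ n₊ = suc-injective (trans (sym m₊) (trans eq n₊))
  from : m % o ≡ n % o → suc m % o ≡ suc n % o
  from eq = trans ([1+m]%n≡[1+m%n]%n m o) (trans (cong (λ r → suc r % o) eq) (sym ([1+m]%n≡[1+m%n]%n n o)))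

count-sameResidue*o+m%o≡m : ∀ m o .{{_ : NonZero o}} → count (λ u → u % o ≡ᵇ m % o) (upTo m) * o + m % o ≡ m
count-sameResidue*o+m%o≡m zero (suc _) = refl
count-sameResidue*o+m%o≡m (suc m) o@(suc k) = begin
  count (λ u → u % o ≡ᵇ suc m % o) (upTo (suc m)) * o + suc m % o
    ≡⟨ cong (λ x → x * o + suc m % o) split ⟩
  (𝟙 (0 ≡ᵇ suc m % o) + c) * o + suc m % o
    ≡⟨ close ([1+m]%n≡0⊎[1+m]%n≡1+m%n m o) ⟩
  suc m ∎
  where
  open ≡-Reasoning
  c : ℕ
  c = count (λ u → u % o ≡ᵇ m % o) (upTo m)
  split : count (λ u → u % o ≡ᵇ suc m % o) (upTo (suc m)) ≡ 𝟙 (0 ≡ᵇ suc m % o) + c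
  split = trans (count-upTo-sucˡ (λ u → u % o ≡ᵇ suc m % o) m) (cong (𝟙 (0 ≡ᵇ suc m % o) +_)
    (count-cong (λ u → does-⇔ ([1+m]%o≡[1+n]%o⇔m%o≡n%o u m o) (suc u % o ≟ suc m % o) (u % o ≟ m % o)) (upTo m)))
  close : suc m % o ≡ 0 ⊎ suc m % o ≡ suc (m % o) → (𝟙 (0 ≡ᵇ suc m % o) + c) * o + suc m % o ≡ suc m
  close (inj₁ [1+m]%o≡0) rewrite [1+m]%o≡0 = begin
    suc c * o + 0        ≡⟨ +-identityʳ (suc c * o) ⟩
    o + c * o            ≡⟨ +-comm o (c * o) ⟩
    c * o + suc k        ≡⟨ +-suc (c * o) k ⟩
    suc (c * o + k)      ≡⟨ cong (λ r → suc (c * o + r)) (sym (%-pred-≡0 [1+m]%o≡0)) ⟩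
    suc (c * o + m % o)  ≡⟨ cong suc (count-sameResidue*o+m%o≡m m o) ⟩
    suc m                ∎
  close (inj₂ [1+m]%o≡[1+m%o]) rewrite [1+m]%o≡[1+m%o] =
    trans (+-suc (c * o) (m % o)) (cong suc (count-sameResidue*o+m%o≡m m o))

count-sameResidue : ∀ m o .{{_ : NonZero o}} → count (λ u → u % o ≡ᵇ m % o) (upTo m) ≡ m / o
count-sameResidue m o = *-cancelʳ-≡ _ (m / o) o (+-cancelʳ-≡ (m % o) _ _
  (trans (count-sameResidue*o+m%o≡m m o) (trans (m≡m%n+[m/n]*n m o) (+-comm (m % o) (m / o * o)))))

-- Turán graphs

T-suc : ∀ N r .{{_ : NonZero r}} → T (suc N) r ≡ T N r + (N ∸ N / r)
T-suc N r = begin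
  T (suc N) r                                        ≡⟨ length-filter≡count differentParts (pairsBelow (suc N)) ⟩
  count differentParts (pairsBelow (suc N))          ≡⟨ cong (count differentParts ∘ concatMap pairsEndingAt) (sym (upTo-∷ʳ N)) ⟩
  count differentParts (concatMap pairsEndingAt (upTo N ++ [ N ]))
    ≡⟨ cong (count differentParts) (concatMap-++ pairsEndingAt (upTo N) [ N ]) ⟩
  count differentParts (pairsBelow N ++ (pairsEndingAt N ++ []))
    ≡⟨ count-++ differentParts (pairsBelow N) _ ⟩
  count differentParts (pairsBelow N) + count differentParts (pairsEndingAt N ++ [])
    ≡⟨ cong₂ _+_ (sym (length-filter≡count differentParts (pairsBelow N)))
                 (trans (cong (count differentParts) (++-identityʳ (pairsEndingAt N))) (count-map differentParts _ (upTo N))) ⟩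
  T N r + count (not ∘ (λ u → u % r ≡ᵇ N % r)) (upTo N)
    ≡⟨ cong (T N r +_) (count-not (λ u → u % r ≡ᵇ N % r) (upTo N)) ⟩
  T N r + (length (upTo N) ∸ count (λ u → u % r ≡ᵇ N % r) (upTo N))
    ≡⟨ cong (T N r +_) (cong₂ _∸_ (length-upTo N) (count-sameResidue N r)) ⟩
  T N r + (N ∸ N / r) ∎
  where
  open ≡-Reasoning
  -- copies of the local definitions of T, so that T M r unfolds to count differentParts (pairsBelow M)
  differentParts : ℕ × ℕ → Bool
  differentParts (u , v) = not (u % r ≡ᵇ v % r)
  pairsEndingAt : ℕ → List (ℕ × ℕ)
  pairsEndingAt v = map (λ u → (u , v)) (upTo v)
  pairsBelow : ℕ → List (ℕ × ℕ)
  pairsBelow M = concatMap pairsEndingAt (upTo M)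

boundedSizeᵇ : ℕ → ℕ → ℕ → Bool
boundedSizeᵇ p a ℓ = ℓ ≤ᵇ p * a

Sr≡countIntervals : ∀ n p → Sr n p ≡ countIntervals (boundedSizeᵇ p) n
Sr≡countIntervals n p = trans (length-filter≡count (goodᵇ p) (allSubsets n))
  (trans (count-cong goodᵇ≡intervalWithᵇ (allSubsets n)) (count-intervalWithᵇ n (boundedSizeᵇ p)))
  where
  goodᵇ≡intervalWithᵇ : ∀ F → goodᵇ p F ≡ intervalWithᵇ (boundedSizeᵇ p) F
  goodᵇ≡intervalWithᵇ F = cong (nonemptyᵇ F ∧_) (trans (∧-comm (∣ F ∣ ≤ᵇ p * minSet F) (intervalᵇ F))
    (cong (_∧ (∣ F ∣ ≤ᵇ p * minSet F)) (intervalᵇ≡isInterval F)))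

countIntervals≡T : ∀ n p → countIntervals (boundedSizeᵇ p) n ≡ T (suc n) (suc p)
countIntervals≡T zero p = refl
countIntervals≡T (suc n) p = begin
  countIntervals (boundedSizeᵇ p) (suc n)
    ≡⟨ countIntervals-suc n (boundedSizeᵇ p) ⟩
  countIntervals (boundedSizeᵇ p) n + count (λ i → suc n ∸ i ≤ᵇ p * suc i) (upTo (suc n))
    ≡⟨ cong₂ _+_ (countIntervals≡T n p) (count-∸≤ᵇ*suc-upTo (suc n) p) ⟩
  T (suc n) (suc p) + (suc n ∸ suc n / suc p)
    ≡⟨ sym (T-suc (suc n) (suc p)) ⟩
  T (suc (suc n)) (suc p) ∎
  where open ≡-Reasoning

-- The identity holds for all n and p.
theorem1p2 : (n p : ℕ) → n ≥ 1 → p ≥ 1 → n ≥ p → Sr n p ≡ T (suc n) (suc p)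
theorem1p2 n p _ _ _ = begin
  Sr n p                                ≡⟨ Sr≡countIntervals n p ⟩
  countIntervals (boundedSizeᵇ p) n     ≡⟨ countIntervals≡T n p ⟩
  T (suc n) (suc p)                     ∎
  where open ≡-Reasoning
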